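{- For all positive integers $k$ and $N$, there exists a $(4k-2)$-regular graph $G$ such that for every partition of $V(G)$ into $k$ sets $X_1,X_2,\ldots,X_k$, there exists $i$ with $1\le i\le k$ such that some connected component of $G[X_i]$ contains at least $N$ vertices.
   Context: All graphs are finite and simple; $G[X]$ denotes the subgraph of $G$ induced on $X$. -}

module Defs where

open import Data.Nat using (ℕ; suc; _≤_)
open import Data.Fin using (Fin)
open import Data.Bool using (Bool; true; false; T)
open import Data.List using (List; length; filter; allFin)
open import Data.List.Relation.Unary.All using (All)
open import Data.List.Relation.Unary.Unique.Propositional using (Unique)
open import Data.Product using (Σ; _×_; ∃-syntax)
open import Relation.Binary.PropositionalEquality using (_≡_)
open import Relation.Nullary.Decidable using (does)
open import Relation.Unary using (Pred)
open import Level using (0ℓ)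

record Graph : Set where
  field
    n     : ℕ
    adj   : Fin n → Fin n → Bool
    sym   : ∀ u v → adj u v ≡ adj v u
    irrefl : ∀ v → adj v v ≡ false

open Graph public

Vertex : Graph → Set
Vertex G = Fin (n G)

degree : (G : Graph) → Vertex G → ℕ
degree G v = length (filter (λ u → T? (adj G v u)) (allFin (n G)))
  where
  open import Data.Bool.Properties using (T?)

Regular : ℕ → Graph → Set
Regular d G = ∀ v → degree G v ≡ d

data ConnIn (G : Graph) (X : Vertex G → Set) : Vertex G → Vertex G → Set where
  here : ∀ {u} → X u → ConnIn G X u u
  step : ∀ {u v w} → X u → T (adj G u v) → ConnIn G X v w → ConnIn G X u w

-- Some connected component of G[X] contains at least N vertices:
-- there is a vertex v and a list of at least N distinct vertices, each in
-- the component of G[X] containing v.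
HasBigComponent : (G : Graph) → (Vertex G → Set) → ℕ → Set
HasBigComponent G X N =
  Σ (Vertex G) λ v → Σ (List (Vertex G)) λ ws →
    Unique ws × N ≤ length ws × All (ConnIn G X v) ws

module Submission where

-- The graph is the line graph of a 2k-regular Cayley graph of large girth.
-- After generalities on finite types, GirthAction abstracts such a graph: k
-- free generators acting on a finite set, with no short reduced word fixing
-- a point.  girth-action builds one for every bound L from the matrices
-- B(j+1) A(1) B(j+1), which play ping-pong on ℤ², reduced modulo 1 + K^L.  For a colouring, if
-- no colour class had a non-backtracking walk with N edges, orienting edges
-- towards longer monochromatic walks would make the source injective on each
-- colour class; counting then makes every vertex a source in every colour,
-- and following sources the walk lengths would decrease forever.  So a long
-- walk exists; by the girth bound it is a path, giving the component.

open import Defs using (Graph; adj; Vertex; degree; Regular; ConnIn; HasBigComponent)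
open import Data.Nat as ℕ using (ℕ; zero; suc; _+_; _*_; _∸_; _^_; _<_; _≤_; z≤n; s≤s; NonZero)
import Data.Nat.Properties as ℕP
import Data.Nat.DivMod as ℕDivMod
import Data.Nat.Divisibility as ℕDiv
open import Data.Nat.Tactic.RingSolver using () renaming (solve-∀ to ℕ-solve-∀)
open import Data.Integer as ℤ using (ℤ; +_; -[1+_]; ∣_∣; 0ℤ; 1ℤ)
import Data.Integer.Properties as ℤP
import Data.Integer.DivMod as ℤDivMod
import Data.Integer.Divisibility.Signed as ℤDiv
open import Data.Integer.Tactic.RingSolver using (solve-∀)
open import Data.Fin as Fin using (Fin; toℕ)
import Data.Fin.Properties as FinP
open import Data.Bool using (Bool; true; false; not; T; if_then_else_)
open import Data.Bool.Properties using (T?; not-involutive; T-irrelevant)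
open import Data.Product using (Σ; ∃; ∃-syntax; _×_; _,_; proj₁; proj₂)
open import Data.Sum using (_⊎_; inj₁; inj₂)
open import Data.Empty using (⊥; ⊥-elim)
open import Data.Unit using (⊤; tt)
open import Data.List using (List; []; _∷_; length; map; filter; allFin; _++_)
import Data.List.Properties as ListP
open import Data.List.Extrema.Nat using (max; xs≤max; argmax-sel)
open import Data.List.Relation.Unary.Any using (Any; here; there; any?)
open import Data.List.Relation.Unary.All as All using (All; []; _∷_)
import Data.List.Relation.Unary.All.Properties as AllP
import Data.List.Relation.Unary.AllPairs as AllPairs
open import Data.List.Relation.Unary.Unique.Propositional using (Unique)
import Data.List.Relation.Unary.Unique.Propositional.Properties as UniqueP
open import Data.List.Membership.Propositional using (_∈_; find; lose)
open import Data.List.Membership.Propositional.Properties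
  using (∈-map⁺; ∈-map⁻; ∈-filter⁺; ∈-filter⁻; ∈-allFin; ∈-++⁺ˡ; ∈-++⁺ʳ; ∈-++⁻)
open import Data.List.Membership.Propositional.Properties.WithK using (unique∧set⇒bag)
open import Data.List.Relation.Binary.BagAndSetEquality using (∼bag⇒↭)
open import Data.List.Relation.Binary.Permutation.Propositional.Properties using (↭-length)
open import Data.Product.Function.Dependent.Propositional using (Σ-↔)
open import Data.Product.Function.NonDependent.Propositional using (_×-↔_)
open import Data.Sum.Function.Propositional using (_⊎-↔_)
open import Function using (_∘_; id; Injective)
open import Function.Bundles using (Inverse; _↔_; mk↔ₛ′; mk⇔)
open import Function.Construct.Identity using (↔-id)
open import Function.Properties.Inverse using (↔-sym; ↔-trans; ↔⇒↣)
open import Relation.Binary using (DecidableEquality)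
open import Relation.Binary.PropositionalEquality
open import Relation.Nullary using (¬_; Dec; yes; no; ¬?)
open import Relation.Nullary.Decidable using (isYes; toWitness; fromWitness; _×-dec_; via-injection)
open import Relation.Unary using (Decidable)

record Finite (A : Set) : Set where
  field
    size      : ℕ
    bijection : A ↔ Fin size

  index : A → Fin size
  index = Inverse.to bijection

  element : Fin size → A
  element = Inverse.from bijection

  element-index : ∀ a → element (index a) ≡ a
  element-index = Inverse.strictlyInverseʳ bijection

  index-element : ∀ i → index (element i) ≡ i
  index-element = Inverse.strictlyInverseˡ bijection

  index-injective : Injective _≡_ _≡_ index
  index-injective {a} {b} eq =
    trans (sym (element-index a)) (trans (cong element eq) (element-index b))

  element-injective : Injective _≡_ _≡_ element
  element-injective {i} {j} eq =
    trans (sym (index-element i)) (trans (cong index eq) (index-element j))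

  _≟_ : DecidableEquality A
  _≟_ = via-injection (↔⇒↣ bijection) FinP._≟_

  elements : List A
  elements = map element (allFin size)

  elements-unique : Unique elements
  elements-unique = UniqueP.map⁺ element-injective (UniqueP.allFin⁺ size)

  ∈-elements : ∀ a → a ∈ elements
  ∈-elements a = subst (_∈ elements) (element-index a) (∈-map⁺ element (∈-allFin (index a)))

  search : {P : A → Set} → Decidable P → (∀ a → P a) ⊎ ∃ λ a → ¬ P a
  search {P} P? with FinP.all? (P? ∘ element)
  ... | yes all = inj₁ λ a → subst P (element-index a) (all (index a))
  ... | no ¬all = let (i , ¬p) = FinP.¬∀⟶∃¬ size _ (P? ∘ element) ¬all in inj₂ (element i , ¬p)

-- Pigeonhole principle: an injective map of Fin n to itself is onto, since
-- a missed value would give an injection of Fin n into Fin (n - 1).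
injective⇒surjective-Fin : ∀ {n} (f : Fin n → Fin n) → Injective _≡_ _≡_ f → ∀ y → ∃ λ x → f x ≡ y
injective⇒surjective-Fin {suc n} f f-inj y with FinP.any? (λ x → f x FinP.≟ y)
... | yes hit = hit
... | no miss = ⊥-elim (ℕP.<-irrefl refl (FinP.injective⇒≤ punched-injective))
  where
  punched : Fin (suc n) → Fin n
  punched x = Fin.punchOut {i = y} (λ eq → miss (x , sym eq))
  punched-injective : Injective _≡_ _≡_ punched
  punched-injective eq = f-inj (FinP.punchOut-injective {i = y} _ _ eq)

module _ {A : Set} (FA : Finite A) where
  open Finite FA

  injective⇒surjective : (f : A → A) → Injective _≡_ _≡_ f → ∀ y → ∃ λ x → f x ≡ y
  injective⇒surjective f f-inj y =
    let (i , hit) = injective⇒surjective-Fin (index ∘ f ∘ element)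
                      (element-injective ∘ f-inj ∘ index-injective) (index y)
    in element i , index-injective hit

open Finite using (size; bijection)

finite-Fin : ∀ n → Finite (Fin n)
finite-Fin n = record { size = n ; bijection = ↔-id _ }

finite-Bool : Finite Bool
finite-Bool = record { size = 2 ; bijection = ↔-sym FinP.2↔Bool }

finite-× : ∀ {A B} → Finite A → Finite B → Finite (A × B)
finite-× FA FB = record
  { size = size FA * size FB
  ; bijection = ↔-trans (bijection FA ×-↔ bijection FB) (↔-sym FinP.*↔×) }

finite-Σ-Fin : ∀ n (P : Fin n → Bool) → Finite (Σ (Fin n) (T ∘ P))
finite-Σ-Fin zero P = record
  { size = 0 ; bijection = mk↔ₛ′ (λ ()) (λ ()) (λ ()) (λ ()) }
finite-Σ-Fin (suc n) P = record
  { size = bit (P Fin.zero) + size rest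
  ; bijection = ↔-trans split (↔-trans (T↔Fin (P Fin.zero) ⊎-↔ bijection rest) (↔-sym FinP.+↔⊎)) }
  where
  rest = finite-Σ-Fin n (P ∘ Fin.suc)
  bit : Bool → ℕ
  bit b = if b then 1 else 0
  T↔Fin : ∀ b → T b ↔ Fin (bit b)
  T↔Fin true = ↔-sym FinP.1↔⊤
  T↔Fin false = ↔-sym FinP.0↔⊥
  split : Σ (Fin (suc n)) (T ∘ P) ↔ (T (P Fin.zero) ⊎ Σ (Fin n) (T ∘ P ∘ Fin.suc))
  split = mk↔ₛ′ to from to-from from-to
    where
    to : Σ (Fin (suc n)) (T ∘ P) → T (P Fin.zero) ⊎ Σ (Fin n) (T ∘ P ∘ Fin.suc)
    to (Fin.zero , t) = inj₁ t
    to (Fin.suc i , t) = inj₂ (i , t)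
    from : T (P Fin.zero) ⊎ Σ (Fin n) (T ∘ P ∘ Fin.suc) → Σ (Fin (suc n)) (T ∘ P)
    from (inj₁ t) = Fin.zero , t
    from (inj₂ (i , t)) = Fin.suc i , t
    to-from : ∀ x → to (from x) ≡ x
    to-from (inj₁ t) = refl
    to-from (inj₂ (i , t)) = refl
    from-to : ∀ x → from (to x) ≡ x
    from-to (Fin.zero , t) = refl
    from-to (Fin.suc i , t) = refl

finite-Σ : ∀ {A} → Finite A → (P : A → Bool) → Finite (Σ A (T ∘ P))
finite-Σ FA P = record
  { size = size FΣ
  ; bijection = ↔-trans (Σ-↔ (bijection FA) fibre) (bijection FΣ) }
  where
  open Finite FA using (element; index; element-index)
  FΣ = finite-Σ-Fin (size FA) (P ∘ element)
  fibre : ∀ {a} → T (P a) ↔ T (P (element (index a)))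
  fibre {a} = subst (λ x → T (P a) ↔ T (P x)) (sym (element-index a)) (↔-id _)

same-length : ∀ {A : Set} {xs ys : List A} → Unique xs → Unique ys →
              (∀ {x} → x ∈ xs → x ∈ ys) → (∀ {x} → x ∈ ys → x ∈ xs) → length xs ≡ length ys
same-length xs! ys! xs⊆ys ys⊆xs = ↭-length (∼bag⇒↭ (unique∧set⇒bag xs! ys! (mk⇔ xs⊆ys ys⊆xs)))

-- The largest value of an ℕ-valued function on a list (0 on the empty list).
maxOf : ∀ {A : Set} → (A → ℕ) → List A → ℕ
maxOf f xs = max 0 (map f xs)

≤-maxOf : ∀ {A : Set} (f : A → ℕ) {x xs} → x ∈ xs → f x ≤ maxOf f xs
≤-maxOf f {xs = xs} x∈xs = All.lookup (xs≤max 0 (map f xs)) (∈-map⁺ f x∈xs)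

maxOf-attained : ∀ {A : Set} (f : A → ℕ) xs {m} → suc m ≤ maxOf f xs → ∃ λ x → x ∈ xs × suc m ≤ f x
maxOf-attained f xs {m} m<max with argmax-sel id 0 (map f xs)
... | inj₁ max≡0 = ⊥-elim (ℕP.n≮0 (subst (m <_) max≡0 m<max))
... | inj₂ max∈ with ∈-map⁻ f max∈
...   | x , x∈xs , max≡fx = x , x∈xs , subst (suc m ≤_) max≡fx m<max

maxOf-cong : ∀ {A : Set} (f g : A → ℕ) xs → (∀ {x} → x ∈ xs → f x ≡ g x) → maxOf f xs ≡ maxOf g xs
maxOf-cong f g xs f≡g = cong (max 0) (ListP.map-cong-local (All.tabulate f≡g))

-- Letters: the generators of the free group on k letters and their inverses.
Letter : ℕ → Set
Letter k = Fin k × Bool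

inv : ∀ {k} → Letter k → Letter k
inv (j , b) = (j , not b)

inv-involutive : ∀ {k} (ℓ : Letter k) → inv (inv ℓ) ≡ ℓ
inv-involutive (j , b) = cong (j ,_) (not-involutive b)

finite-Letter : ∀ k → Finite (Letter k)
finite-Letter k = finite-× (finite-Fin k) finite-Bool

-- A word is a list of letters, the head being the letter applied last; it
-- is reduced when no letter is adjacent to its inverse.
Reduced : ∀ {k} → List (Letter k) → Set
Reduced [] = ⊤
Reduced (ℓ ∷ []) = ⊤
Reduced (ℓ ∷ ℓ' ∷ w) = ℓ ≢ inv ℓ' × Reduced (ℓ' ∷ w)

reduced-tail : ∀ {k} {ℓ : Letter k} w → Reduced (ℓ ∷ w) → Reduced w
reduced-tail [] _ = tt
reduced-tail (ℓ' ∷ w) (_ , reduced) = reduced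

-- A right action of the letters, extended to words (act* _·_ g [ℓ₂ , ℓ₁] = g · ℓ₁ · ℓ₂).
act* : ∀ {k} {Ω : Set} → (Ω → Letter k → Ω) → Ω → List (Letter k) → Ω
act* _·_ g [] = g
act* _·_ g (ℓ ∷ w) = act* _·_ g w · ℓ

-- A finite nonempty set with an action of the letters in which inverse
-- letters cancel and no reduced word of length 1, ..., L fixes a point:
-- its Cayley graph is 2k-regular of girth greater than L.
record GirthAction (k L : ℕ) : Set₁ where
  infixl 6 _·_
  field
    Ω      : Set
    finite : Finite Ω
    base   : Ω
    _·_    : Ω → Letter k → Ω
    cancel : ∀ g ℓ → (g · ℓ) · inv ℓ ≡ g
    girth  : ∀ g w → Reduced w → 1 ≤ length w → length w ≤ L → act* _·_ g w ≢ g

-- A reduced word sends (0 , 1) into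
-- the region |y| < |x|, while each letter multiplies the norm by at most K.
module PingPong (k : ℕ) where

  Vec2 : Set
  Vec2 = ℤ × ℤ

  -- B(m) = [[1 , 2m] , [0 , 1]] and A(n) = [[1 , 0] , [2n , 1]].
  shearX : ℤ → Vec2 → Vec2
  shearX m (x , y) = (x ℤ.+ + 2 ℤ.* m ℤ.* y , y)

  shearY : ℤ → Vec2 → Vec2
  shearY n (x , y) = (x , y ℤ.+ + 2 ℤ.* n ℤ.* x)

  xCoef : Letter k → ℤ
  xCoef (j , true) = + suc (toℕ j)
  xCoef (j , false) = -[1+ toℕ j ]

  yCoef : Letter k → ℤ
  yCoef (j , true) = 1ℤ
  yCoef (j , false) = ℤ.- 1ℤ

  infixl 5 _·ᵥ_ _·ᵥ*_
  _·ᵥ_ : Vec2 → Letter k → Vec2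
  v ·ᵥ ℓ = shearX (xCoef ℓ) (shearY (yCoef ℓ) (shearX (xCoef ℓ) v))

  _·ᵥ*_ : Vec2 → List (Letter k) → Vec2
  _·ᵥ*_ = act* _·ᵥ_

  InX InY : Vec2 → Set
  InX (x , y) = ∣ y ∣ < ∣ x ∣
  InY (x , y) = ∣ x ∣ < ∣ y ∣

  ∣2ab∣ : ∀ a b → ∣ + 2 ℤ.* a ℤ.* b ∣ ≡ 2 * ∣ a ∣ * ∣ b ∣
  ∣2ab∣ a b = trans (ℤP.∣i*j∣≡∣i∣*∣j∣ (+ 2 ℤ.* a) b) (cong (_* ∣ b ∣) (ℤP.∣i*j∣≡∣i∣*∣j∣ (+ 2) a))

  shear-escapes : ∀ a b c → ∣ a ∣ < ∣ b ∣ → 1 ≤ ∣ c ∣ → ∣ b ∣ < ∣ a ℤ.+ + 2 ℤ.* c ℤ.* b ∣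
  shear-escapes a b c a<b 1≤c = ℕP.+-cancelʳ-< (∣ b ∣) (∣ b ∣) (∣ s ∣) (begin-strict
      ∣ b ∣ + ∣ b ∣            ≡⟨ cong (_+_ (∣ b ∣)) (ℕP.+-identityʳ ∣ b ∣) ⟨
      2 * 1 * ∣ b ∣            ≤⟨ ℕP.*-monoˡ-≤ ∣ b ∣ (ℕP.*-monoʳ-≤ 2 1≤c) ⟩
      2 * ∣ c ∣ * ∣ b ∣        ≡⟨ ∣2ab∣ c b ⟨
      ∣ + 2 ℤ.* c ℤ.* b ∣      ≡⟨ cong ∣_∣ (difference a b c) ⟩
      ∣ s ℤ.- a ∣              ≤⟨ ℤP.∣i+j∣≤∣i∣+∣j∣ s (ℤ.- a) ⟩
      ∣ s ∣ + ∣ ℤ.- a ∣        ≡⟨ cong (_+_ (∣ s ∣)) (ℤP.∣-i∣≡∣i∣ a) ⟩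
      ∣ s ∣ + ∣ a ∣            <⟨ ℕP.+-monoʳ-< ∣ s ∣ a<b ⟩
      ∣ s ∣ + ∣ b ∣            ∎)
    where
    open ℕP.≤-Reasoning
    s = a ℤ.+ + 2 ℤ.* c ℤ.* b
    difference : ∀ a b c → + 2 ℤ.* c ℤ.* b ≡ (a ℤ.+ + 2 ℤ.* c ℤ.* b) ℤ.- a
    difference = solve-∀

  shearX-InY→InX : ∀ m v → 1 ≤ ∣ m ∣ → InY v → InX (shearX m v)
  shearX-InY→InX m (x , y) 1≤m v∈Y = shear-escapes x y m v∈Y 1≤m

  shearY-InX→InY : ∀ n v → 1 ≤ ∣ n ∣ → InX v → InY (shearY n v)
  shearY-InX→InY n (x , y) 1≤n v∈X = shear-escapes y x n v∈X 1≤n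

  shearX-cancel : ∀ m v → shearX (ℤ.- m) (shearX m v) ≡ v
  shearX-cancel m (x , y) = cong (_, y) (identity x y m)
    where
    identity : ∀ x y m → (x ℤ.+ + 2 ℤ.* m ℤ.* y) ℤ.+ + 2 ℤ.* (ℤ.- m) ℤ.* y ≡ x
    identity = solve-∀

  shearY-cancel : ∀ n v → shearY (ℤ.- n) (shearY n v) ≡ v
  shearY-cancel n (x , y) = cong (x ,_) (identity x y n)
    where
    identity : ∀ x y n → (y ℤ.+ + 2 ℤ.* n ℤ.* x) ℤ.+ + 2 ℤ.* (ℤ.- n) ℤ.* x ≡ y
    identity = solve-∀

  shearX-shift : ∀ m m' v → shearX m' v ≡ shearX (m' ℤ.+ m) (shearX (ℤ.- m) v)
  shearX-shift m m' (x , y) = cong (_, y) (identity x y m m')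
    where
    identity : ∀ x y m m' → x ℤ.+ + 2 ℤ.* m' ℤ.* y
                          ≡ (x ℤ.+ + 2 ℤ.* (ℤ.- m) ℤ.* y) ℤ.+ + 2 ℤ.* (m' ℤ.+ m) ℤ.* y
    identity = solve-∀

  triple-cancel : ∀ m n v → shearX (ℤ.- m) (shearY (ℤ.- n) (shearX (ℤ.- m) (shearX m (shearY n (shearX m v))))) ≡ v
  triple-cancel m n v = begin
    shearX (ℤ.- m) (shearY (ℤ.- n) (shearX (ℤ.- m) (shearX m (shearY n (shearX m v)))))
      ≡⟨ cong (shearX (ℤ.- m) ∘ shearY (ℤ.- n)) (shearX-cancel m (shearY n (shearX m v))) ⟩
    shearX (ℤ.- m) (shearY (ℤ.- n) (shearY n (shearX m v)))
      ≡⟨ cong (shearX (ℤ.- m)) (shearY-cancel n (shearX m v)) ⟩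
    shearX (ℤ.- m) (shearX m v)
      ≡⟨ shearX-cancel m v ⟩
    v ∎
    where open ≡-Reasoning

  ·ᵥ-cancel : ∀ v ℓ → v ·ᵥ ℓ ·ᵥ inv ℓ ≡ v
  ·ᵥ-cancel v (j , true) = triple-cancel (xCoef (j , true)) (yCoef (j , true)) v
  ·ᵥ-cancel v (j , false) = triple-cancel (xCoef (j , false)) (yCoef (j , false)) v

  xCoef-inv : ∀ ℓ → xCoef (inv ℓ) ≡ ℤ.- xCoef ℓ
  xCoef-inv (j , true) = refl
  xCoef-inv (j , false) = refl

  xCoef-injective : ∀ {ℓ ℓ'} → xCoef ℓ ≡ xCoef ℓ' → ℓ ≡ ℓ'
  xCoef-injective {j , true} {j' , true} eq =
    cong (_, true) (FinP.toℕ-injective (ℤP.+[1+-injective eq))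
  xCoef-injective {j , false} {j' , false} eq =
    cong (_, false) (FinP.toℕ-injective (ℤP.-[1+-injective eq))

  nonzero : ∀ {z} → z ≢ 0ℤ → 1 ≤ ∣ z ∣
  nonzero z≢0 = ℕP.n≢0⇒n>0 (z≢0 ∘ ℤP.∣i∣≡0⇒i≡0)

  1≤∣xCoef∣ : ∀ ℓ → 1 ≤ ∣ xCoef ℓ ∣
  1≤∣xCoef∣ (j , true) = s≤s z≤n
  1≤∣xCoef∣ (j , false) = s≤s z≤n

  1≤∣yCoef∣ : ∀ ℓ → 1 ≤ ∣ yCoef ℓ ∣
  1≤∣yCoef∣ (j , true) = s≤s z≤n
  1≤∣yCoef∣ (j , false) = s≤s z≤n

  -- Consecutive letters of a reduced word have outer coefficients with
  -- nonzero sum, since xCoef is injective and odd.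
  xCoef-sum-nonzero : ∀ {ℓ ℓ'} → ℓ ≢ inv ℓ' → 1 ≤ ∣ xCoef ℓ ℤ.+ xCoef ℓ' ∣
  xCoef-sum-nonzero {ℓ} {ℓ'} ℓ≢ℓ'⁻¹ = nonzero λ sum≡0 →
    ℓ≢ℓ'⁻¹ (xCoef-injective (trans (negated sum≡0) (sym (xCoef-inv ℓ'))))
    where
    negated : ∀ {a b} → a ℤ.+ b ≡ 0ℤ → a ≡ ℤ.- b
    negated {a} {b} eq = ℤP.i-j≡0⇒i≡j a (ℤ.- b) (trans (cong (ℤ._+_ a) (ℤP.neg-involutive b)) eq)

  v₀ : Vec2
  v₀ = (0ℤ , 1ℤ)

  -- The ping-pong invariant after a word whose last letter is ℓ: undoing the
  -- outer shear of ℓ lands in InY.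
  Entered : Letter k → Vec2 → Set
  Entered ℓ v = InY (shearX (ℤ.- xCoef ℓ) v)

  ·ᵥ-enters : ∀ ℓ v → InX (shearX (xCoef ℓ) v) → Entered ℓ (v ·ᵥ ℓ)
  ·ᵥ-enters ℓ v outer∈X = subst InY (sym (shearX-cancel (xCoef ℓ) inner))
    (shearY-InX→InY (yCoef ℓ) (shearX (xCoef ℓ) v) (1≤∣yCoef∣ ℓ) outer∈X)
    where
    inner = shearY (yCoef ℓ) (shearX (xCoef ℓ) v)

  entered : ∀ ℓ w → Reduced (ℓ ∷ w) → Entered ℓ (v₀ ·ᵥ* (ℓ ∷ w))
  entered ℓ [] _ = ·ᵥ-enters ℓ v₀ (shearX-InY→InX (xCoef ℓ) v₀ (1≤∣xCoef∣ ℓ) (s≤s z≤n))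
  entered ℓ (ℓ' ∷ w) (ℓ≢ℓ'⁻¹ , reduced) = ·ᵥ-enters ℓ v
    (subst InX (sym (shearX-shift (xCoef ℓ') (xCoef ℓ) v))
      (shearX-InY→InX (xCoef ℓ ℤ.+ xCoef ℓ') (shearX (ℤ.- xCoef ℓ') v)
        (xCoef-sum-nonzero ℓ≢ℓ'⁻¹) (entered ℓ' w reduced)))
    where
    v = v₀ ·ᵥ* (ℓ' ∷ w)

  ping-pong : ∀ ℓ w → Reduced (ℓ ∷ w) → InX (v₀ ·ᵥ* (ℓ ∷ w))
  ping-pong ℓ w reduced = subst InX (redo (xCoef ℓ) v)
    (shearX-InY→InX (xCoef ℓ) (shearX (ℤ.- xCoef ℓ) v) (1≤∣xCoef∣ ℓ) (entered ℓ w reduced))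
    where
    v = v₀ ·ᵥ* (ℓ ∷ w)
    redo : ∀ m v → shearX m (shearX (ℤ.- m) v) ≡ v
    redo m v = trans (cong (λ t → shearX t (shearX (ℤ.- m) v)) (sym (ℤP.neg-involutive m)))
                     (shearX-cancel (ℤ.- m) v)

  norm : Vec2 → ℕ
  norm (x , y) = ∣ x ∣ + ∣ y ∣

  -- A shear with coefficient at most k multiplies the norm by at most
  -- stretch = 2k + 1, so a letter multiplies it by at most K = stretch³.
  stretch K : ℕ
  stretch = suc (2 * k)
  K = stretch ^ 3

  shear-norm : ∀ x y m → ∣ m ∣ ≤ k → ∣ x ℤ.+ + 2 ℤ.* m ℤ.* y ∣ + ∣ y ∣ ≤ stretch * (∣ x ∣ + ∣ y ∣)
  shear-norm x y m m≤k = begin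
    ∣ x ℤ.+ + 2 ℤ.* m ℤ.* y ∣ + ∣ y ∣
      ≤⟨ ℕP.+-monoˡ-≤ ∣ y ∣ (ℤP.∣i+j∣≤∣i∣+∣j∣ x (+ 2 ℤ.* m ℤ.* y)) ⟩
    ∣ x ∣ + ∣ + 2 ℤ.* m ℤ.* y ∣ + ∣ y ∣
      ≡⟨ cong (λ t → ∣ x ∣ + t + ∣ y ∣) (∣2ab∣ m y) ⟩
    ∣ x ∣ + 2 * ∣ m ∣ * ∣ y ∣ + ∣ y ∣
      ≤⟨ ℕP.+-monoˡ-≤ ∣ y ∣ (ℕP.+-monoʳ-≤ ∣ x ∣ (ℕP.*-monoˡ-≤ ∣ y ∣ (ℕP.*-monoʳ-≤ 2 m≤k))) ⟩
    ∣ x ∣ + 2 * k * ∣ y ∣ + ∣ y ∣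
      ≤⟨ ℕP.m≤m+n _ (2 * k * ∣ x ∣) ⟩
    ∣ x ∣ + 2 * k * ∣ y ∣ + ∣ y ∣ + 2 * k * ∣ x ∣
      ≡⟨ expand ∣ x ∣ ∣ y ∣ k ⟨
    stretch * (∣ x ∣ + ∣ y ∣) ∎
    where
    open ℕP.≤-Reasoning
    expand : ∀ a b k → suc (2 * k) * (a + b) ≡ a + 2 * k * b + b + 2 * k * a
    expand = ℕ-solve-∀

  shearX-norm : ∀ m v → ∣ m ∣ ≤ k → norm (shearX m v) ≤ stretch * norm v
  shearX-norm m (x , y) = shear-norm x y m

  shearY-norm : ∀ n v → ∣ n ∣ ≤ k → norm (shearY n v) ≤ stretch * norm v
  shearY-norm n (x , y) n≤k = subst₂ _≤_ (ℕP.+-comm _ ∣ x ∣) (cong (stretch *_) (ℕP.+-comm ∣ y ∣ ∣ x ∣))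
    (shear-norm y x n n≤k)

  ∣xCoef∣≤k : ∀ ℓ → ∣ xCoef ℓ ∣ ≤ k
  ∣xCoef∣≤k (j , true) = FinP.toℕ<n j
  ∣xCoef∣≤k (j , false) = FinP.toℕ<n j

  ∣yCoef∣≤k : ∀ ℓ → ∣ yCoef ℓ ∣ ≤ k
  ∣yCoef∣≤k (j , true) = ℕP.≤-trans (s≤s z≤n) (FinP.toℕ<n j)
  ∣yCoef∣≤k (j , false) = ℕP.≤-trans (s≤s z≤n) (FinP.toℕ<n j)

  ·ᵥ-norm : ∀ v ℓ → norm (v ·ᵥ ℓ) ≤ K * norm v
  ·ᵥ-norm v ℓ = begin
    norm (shearX m (shearY n (shearX m v)))
      ≤⟨ shearX-norm m (shearY n (shearX m v)) (∣xCoef∣≤k ℓ) ⟩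
    stretch * norm (shearY n (shearX m v))
      ≤⟨ ℕP.*-monoʳ-≤ stretch (shearY-norm n (shearX m v) (∣yCoef∣≤k ℓ)) ⟩
    stretch * (stretch * norm (shearX m v))
      ≤⟨ ℕP.*-monoʳ-≤ stretch (ℕP.*-monoʳ-≤ stretch (shearX-norm m v (∣xCoef∣≤k ℓ))) ⟩
    stretch * (stretch * (stretch * norm v))
      ≡⟨ cube stretch (norm v) ⟩
    K * norm v ∎
    where
    open ℕP.≤-Reasoning
    m = xCoef ℓ
    n = yCoef ℓ
    cube : ∀ c a → c * (c * (c * a)) ≡ c * (c * (c * 1)) * a
    cube = ℕ-solve-∀

  ·ᵥ*-norm : ∀ v w → norm (v ·ᵥ* w) ≤ K ^ length w * norm v
  ·ᵥ*-norm v [] = ℕP.≤-reflexive (sym (ℕP.+-identityʳ (norm v)))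
  ·ᵥ*-norm v (ℓ ∷ w) = begin
    norm (v ·ᵥ* w ·ᵥ ℓ)         ≤⟨ ·ᵥ-norm (v ·ᵥ* w) ℓ ⟩
    K * norm (v ·ᵥ* w)          ≤⟨ ℕP.*-monoʳ-≤ K (·ᵥ*-norm v w) ⟩
    K * (K ^ length w * norm v) ≡⟨ ℕP.*-assoc K (K ^ length w) (norm v) ⟨
    K ^ length (ℓ ∷ w) * norm v ∎
    where open ℕP.≤-Reasoning

  module ShearClosed (P : (Vec2 → Vec2) → Set)
    (id-has : P (λ v → v)) (∘-has : ∀ f g → P f → P g → P (f ∘ g))
    (shearX-has : ∀ m → P (shearX m)) (shearY-has : ∀ n → P (shearY n)) where

    letter-has : ∀ ℓ → P (_·ᵥ ℓ)
    letter-has ℓ = ∘-has _ _ (shearX-has m) (∘-has _ _ (shearY-has (yCoef ℓ)) (shearX-has m))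
      where m = xCoef ℓ

    word-has : ∀ w → P (_·ᵥ* w)
    word-has [] = id-has
    word-has (ℓ ∷ w) = ∘-has _ _ (letter-has ℓ) (word-has w)

  infixl 6 _⊕_
  infixl 7 _⊙_
  _⊕_ : Vec2 → Vec2 → Vec2
  u ⊕ u' = (proj₁ u ℤ.+ proj₁ u' , proj₂ u ℤ.+ proj₂ u')

  _⊙_ : ℤ → Vec2 → Vec2
  a ⊙ u = (a ℤ.* proj₁ u , a ℤ.* proj₂ u)

  Linear : (Vec2 → Vec2) → Set
  Linear f = ∀ a u b u' → f (a ⊙ u ⊕ b ⊙ u') ≡ a ⊙ f u ⊕ b ⊙ f u'

  word-linear : ∀ w → Linear (_·ᵥ* w)
  word-linear = ShearClosed.word-has Linear (λ _ _ _ _ → refl) ∘-linear shearX-linear shearY-linear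
    where
    ∘-linear : ∀ f g → Linear f → Linear g → Linear (f ∘ g)
    ∘-linear f g f-lin g-lin a u b u' = trans (cong f (g-lin a u b u')) (f-lin a (g u) b (g u'))
    shear-identity : ∀ m a x y b x' y' →
      (a ℤ.* x ℤ.+ b ℤ.* x') ℤ.+ + 2 ℤ.* m ℤ.* (a ℤ.* y ℤ.+ b ℤ.* y')
        ≡ a ℤ.* (x ℤ.+ + 2 ℤ.* m ℤ.* y) ℤ.+ b ℤ.* (x' ℤ.+ + 2 ℤ.* m ℤ.* y')
    shear-identity = solve-∀
    shearX-linear : ∀ m → Linear (shearX m)
    shearX-linear m a (x , y) b (x' , y') = cong (_, _) (shear-identity m a x y b x' y')
    shearY-linear : ∀ n → Linear (shearY n)
    shearY-linear n a (x , y) b (x' , y') = cong (_ ,_) (shear-identity n a y x b y' x')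

  det : Vec2 → Vec2 → ℤ
  det u u' = proj₁ u ℤ.* proj₂ u' ℤ.- proj₂ u ℤ.* proj₁ u'

  PreservesDet : (Vec2 → Vec2) → Set
  PreservesDet f = ∀ u u' → det (f u) (f u') ≡ det u u'

  letter-preserves-det : ∀ ℓ → PreservesDet (_·ᵥ ℓ)
  letter-preserves-det = ShearClosed.letter-has PreservesDet (λ _ _ → refl) ∘-preserves
    shearX-preserves shearY-preserves
    where
    ∘-preserves : ∀ f g → PreservesDet f → PreservesDet g → PreservesDet (f ∘ g)
    ∘-preserves f g f-det g-det u u' = trans (f-det (g u) (g u')) (g-det u u')
    shearX-preserves : ∀ m → PreservesDet (shearX m)
    shearX-preserves m (x , y) (x' , y') = identity x y x' y' m
      where
      identity : ∀ x y x' y' m → (x ℤ.+ + 2 ℤ.* m ℤ.* y) ℤ.* y' ℤ.- y ℤ.* (x' ℤ.+ + 2 ℤ.* m ℤ.* y')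
                                 ≡ x ℤ.* y' ℤ.- y ℤ.* x'
      identity = solve-∀
    shearY-preserves : ∀ n → PreservesDet (shearY n)
    shearY-preserves n (x , y) (x' , y') = identity x y x' y' n
      where
      identity : ∀ x y x' y' n → x ℤ.* (y' ℤ.+ + 2 ℤ.* n ℤ.* x') ℤ.- (y ℤ.+ + 2 ℤ.* n ℤ.* x) ℤ.* x'
                                 ≡ x ℤ.* y' ℤ.- y ℤ.* x'
      identity = solve-∀

module Congruence (M : ℕ) .{{_ : NonZero M}} where

  infix 4 _≋_
  record _≋_ (a b : ℤ) : Set where
    constructor congruent
    field divisible : + M ℤDiv.∣ a ℤ.- b
  open _≋_

  ≋-refl : ∀ {a} → a ≋ a
  ≋-refl {a} = congruent (ℤDiv.divides 0ℤ (trans (ℤP.+-inverseʳ a) (sym (ℤP.*-zeroˡ (+ M)))))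

  ≡⇒≋ : ∀ {a b} → a ≡ b → a ≋ b
  ≡⇒≋ refl = ≋-refl

  ≋-sym : ∀ {a b} → a ≋ b → b ≋ a
  ≋-sym {a} {b} a≋b = congruent (subst (+ M ℤDiv.∣_) (identity a b) (ℤDiv.∣m⇒∣-m (divisible a≋b)))
    where
    identity : ∀ a b → ℤ.- (a ℤ.- b) ≡ b ℤ.- a
    identity = solve-∀

  ≋-trans : ∀ {a b c} → a ≋ b → b ≋ c → a ≋ c
  ≋-trans {a} {b} {c} a≋b b≋c = congruent (subst (+ M ℤDiv.∣_) (identity a b c) (ℤDiv.∣m∣n⇒∣m+n (divisible a≋b) (divisible b≋c)))
    where
    identity : ∀ a b c → (a ℤ.- b) ℤ.+ (b ℤ.- c) ≡ a ℤ.- c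
    identity = solve-∀

  ≋-+ : ∀ {a a' b b'} → a ≋ a' → b ≋ b' → a ℤ.+ b ≋ a' ℤ.+ b'
  ≋-+ {a} {a'} {b} {b'} a≋a' b≋b' = congruent (subst (+ M ℤDiv.∣_) (identity a a' b b') (ℤDiv.∣m∣n⇒∣m+n (divisible a≋a') (divisible b≋b')))
    where
    identity : ∀ a a' b b' → (a ℤ.- a') ℤ.+ (b ℤ.- b') ≡ (a ℤ.+ b) ℤ.- (a' ℤ.+ b')
    identity = solve-∀

  ≋-* : ∀ {a a' b b'} → a ≋ a' → b ≋ b' → a ℤ.* b ≋ a' ℤ.* b'
  ≋-* {a} {a'} {b} {b'} a≋a' b≋b' = congruent (subst (+ M ℤDiv.∣_) (identity a a' b b')
    (ℤDiv.∣m∣n⇒∣m+n (ℤDiv.∣n⇒∣m*n a (divisible b≋b')) (ℤDiv.∣m⇒∣m*n b' (divisible a≋a'))))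
    where
    identity : ∀ a a' b b' → a ℤ.* (b ℤ.- b') ℤ.+ (a ℤ.- a') ℤ.* b' ≡ a ℤ.* b ℤ.- a' ℤ.* b'
    identity = solve-∀

  ≋-neg : ∀ {a a'} → a ≋ a' → ℤ.- a ≋ ℤ.- a'
  ≋-neg {a} {a'} a≋a' = congruent (subst (+ M ℤDiv.∣_) (identity a a') (ℤDiv.∣m⇒∣-m (divisible a≋a')))
    where
    identity : ∀ a a' → ℤ.- (a ℤ.- a') ≡ ℤ.- a ℤ.- ℤ.- a'
    identity = solve-∀

  small-multiple : ∀ {n} → M ℕDiv.∣ n → n < M → n ≡ 0
  small-multiple {zero} _ _ = refl
  small-multiple {suc n} M∣n n<M = ⊥-elim (ℕDiv.>⇒∤ n<M M∣n)

  ≋-close⇒≡ : ∀ {a b} → a ≋ b → ∣ a ℤ.- b ∣ < M → a ≡ b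
  ≋-close⇒≡ {a} {b} a≋b close =
    ℤP.i-j≡0⇒i≡j a b (ℤP.∣i∣≡0⇒i≡0 (small-multiple (ℤDiv.∣⇒∣ᵤ (divisible a≋b)) close))

  lift : Fin M → ℤ
  lift i = + toℕ i

  reduce : ℤ → Fin M
  reduce z = Fin.fromℕ< (ℤDivMod.n%ℕd<d z M)

  lift-reduce : ∀ z → lift (reduce z) ≋ z
  lift-reduce z = congruent (ℤDiv.divides (ℤ.- q) (begin
      lift (reduce z) ℤ.- z         ≡⟨ cong (λ t → t ℤ.- z) (cong +_ (FinP.toℕ-fromℕ< (ℤDivMod.n%ℕd<d z M))) ⟩
      + r ℤ.- z                     ≡⟨ cong (λ t → + r ℤ.- t) (ℤDivMod.a≡a%ℕn+[a/ℕn]*n z M) ⟩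
      + r ℤ.- (+ r ℤ.+ q ℤ.* + M)   ≡⟨ identity (+ r) q (+ M) ⟩
      ℤ.- q ℤ.* + M                 ∎))
    where
    open ≡-Reasoning
    r = z ℤ.%ℕ M
    q = z ℤ./ℕ M
    identity : ∀ r q m → r ℤ.- (r ℤ.+ q ℤ.* m) ≡ ℤ.- q ℤ.* m
    identity = solve-∀

  reduce-lift : ∀ i → reduce (lift i) ≡ i
  reduce-lift i = FinP.toℕ-injective (trans (FinP.toℕ-fromℕ< _) (ℕDivMod.m<n⇒m%n≡m (FinP.toℕ<n i)))

  ≋⇒reduce≡ : ∀ {a b} → a ≋ b → reduce a ≡ reduce b
  ≋⇒reduce≡ {a} {b} a≋b = FinP.toℕ-injective (ℤP.+-injective (≋-close⇒≡ lifts≋ close))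
    where
    lifts≋ : lift (reduce a) ≋ lift (reduce b)
    lifts≋ = ≋-trans (lift-reduce a) (≋-trans a≋b (≋-sym (lift-reduce b)))
    close : ∣ lift (reduce a) ℤ.- lift (reduce b) ∣ < M
    close = subst (λ t → ∣ t ∣ < M) (sym (ℤP.[+m]-[+n]≡m⊖n ra rb))
      (ℕP.≤-<-trans (ℤP.∣m⊝n∣≤m⊔n ra rb) (ℕP.⊔-lub (FinP.toℕ<n (reduce a)) (FinP.toℕ<n (reduce b))))
      where
      ra = toℕ (reduce a)
      rb = toℕ (reduce b)

-- Reducing the ping-pong matrices modulo M gives an action of the letters on
-- the finite set SL₂(ℤ/M); a reduced word W with K^|W| < M has no fixed point.
module ReducedPingPong (k M : ℕ) .{{_ : NonZero M}} where
  open PingPong k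
  open Congruence M

  infix 4 _≋ᵥ_
  _≋ᵥ_ : Vec2 → Vec2 → Set
  u ≋ᵥ u' = proj₁ u ≋ proj₁ u' × proj₂ u ≋ proj₂ u'

  ≋ᵥ-refl : ∀ u → u ≋ᵥ u
  ≋ᵥ-refl u = ≋-refl , ≋-refl

  ≋ᵥ-sym : ∀ {u u'} → u ≋ᵥ u' → u' ≋ᵥ u
  ≋ᵥ-sym (x≋ , y≋) = ≋-sym x≋ , ≋-sym y≋

  ≋ᵥ-trans : ∀ {u u' u''} → u ≋ᵥ u' → u' ≋ᵥ u'' → u ≋ᵥ u''
  ≋ᵥ-trans (x≋ , y≋) (x≋' , y≋') = ≋-trans x≋ x≋' , ≋-trans y≋ y≋'

  ≡⇒≋ᵥ : ∀ {u u'} → u ≡ u' → u ≋ᵥ u'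
  ≡⇒≋ᵥ {u} refl = ≋ᵥ-refl u

  ⊕-cong : ∀ {u u' w w'} → u ≋ᵥ u' → w ≋ᵥ w' → u ⊕ w ≋ᵥ u' ⊕ w'
  ⊕-cong (x≋ , y≋) (x≋' , y≋') = ≋-+ x≋ x≋' , ≋-+ y≋ y≋'

  ⊙-cong : ∀ a {u u'} → u ≋ᵥ u' → a ⊙ u ≋ᵥ a ⊙ u'
  ⊙-cong a (x≋ , y≋) = ≋-* (≋-refl {a}) x≋ , ≋-* (≋-refl {a}) y≋

  det-cong : ∀ {u u' w w'} → u ≋ᵥ u' → w ≋ᵥ w' → det u w ≋ det u' w'
  det-cong (x≋ , y≋) (x≋' , y≋') = ≋-+ (≋-* x≋ y≋') (≋-neg (≋-* y≋ x≋'))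

  RespectsCongruence : (Vec2 → Vec2) → Set
  RespectsCongruence f = ∀ u u' → u ≋ᵥ u' → f u ≋ᵥ f u'

  ∘-respects : ∀ f g → RespectsCongruence f → RespectsCongruence g → RespectsCongruence (f ∘ g)
  ∘-respects f g f-resp g-resp u u' u≋u' = f-resp (g u) (g u') (g-resp u u' u≋u')

  shearX-respects : ∀ m → RespectsCongruence (shearX m)
  shearX-respects m u u' (x≋ , y≋) = ≋-+ x≋ (≋-* (≋-refl {+ 2 ℤ.* m}) y≋) , y≋

  shearY-respects : ∀ n → RespectsCongruence (shearY n)
  shearY-respects n u u' (x≋ , y≋) = x≋ , ≋-+ y≋ (≋-* (≋-refl {+ 2 ℤ.* n}) x≋)

  open ShearClosed RespectsCongruence (λ _ _ u≋u' → u≋u') ∘-respects shearX-respects shearY-respects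
    renaming (letter-has to letter-respects; word-has to word-respects)

  -- If a reduced word W with K^|W| < M fixed two vectors u, u' of
  -- determinant 1 modulo M, then by linearity it would fix
  -- (0 , 1) ≋ -u'₁ u + u₁ u' modulo M; but W(0 , 1) = (x , y) has
  -- |y| < |x| < M, so x ≋ 0 forces x = 0, which is absurd.
  no-fixed-pair : ∀ u u' → det u u' ≋ 1ℤ → ∀ ℓ w → Reduced (ℓ ∷ w) → K ^ length (ℓ ∷ w) < M →
                  u ·ᵥ* (ℓ ∷ w) ≋ᵥ u → u' ·ᵥ* (ℓ ∷ w) ≋ᵥ u' → ⊥
  no-fixed-pair u u' det≋1 ℓ w reduced small u-fixed u'-fixed =
    ℕP.n≮0 (subst (λ t → ∣ proj₂ image ∣ < t) (cong ∣_∣ x≡0) (ping-pong ℓ w reduced))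
    where
    W = ℓ ∷ w
    image = v₀ ·ᵥ* W
    combination : Vec2
    combination = ℤ.- proj₁ u' ⊙ u ⊕ proj₁ u ⊙ u'
    v₀≋combination : v₀ ≋ᵥ combination
    v₀≋combination = ≡⇒≋ (first (proj₁ u) (proj₁ u')) , ≋-trans (≋-sym det≋1) (≡⇒≋ (second (proj₁ u) (proj₂ u) (proj₁ u') (proj₂ u')))
      where
      first : ∀ a c → 0ℤ ≡ ℤ.- c ℤ.* a ℤ.+ a ℤ.* c
      first = solve-∀
      second : ∀ a b c d → a ℤ.* d ℤ.- b ℤ.* c ≡ ℤ.- c ℤ.* b ℤ.+ a ℤ.* d
      second = solve-∀
    v₀-fixed : image ≋ᵥ v₀
    v₀-fixed = ≋ᵥ-trans (word-respects W v₀ combination v₀≋combination)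
      (≋ᵥ-trans (≡⇒≋ᵥ (word-linear W (ℤ.- proj₁ u') u (proj₁ u) u'))
      (≋ᵥ-trans (⊕-cong (⊙-cong (ℤ.- proj₁ u') u-fixed) (⊙-cong (proj₁ u) u'-fixed))
      (≋ᵥ-sym v₀≋combination)))
    image-small : norm image < M
    image-small = ℕP.≤-<-trans (subst (norm image ≤_) (ℕP.*-identityʳ _) (·ᵥ*-norm v₀ W)) small
    x≡0 : proj₁ image ≡ 0ℤ
    x≡0 = ≋-close⇒≡ (proj₁ v₀-fixed)
      (subst (λ t → ∣ t ∣ < M) (sym (ℤP.+-identityʳ (proj₁ image)))
        (ℕP.≤-<-trans (ℕP.m≤m+n ∣ proj₁ image ∣ _) image-small))

  Row : Set
  Row = Fin M × Fin M

  liftᵥ : Row → Vec2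
  liftᵥ (a , b) = (lift a , lift b)

  reduceᵥ : Vec2 → Row
  reduceᵥ (x , y) = (reduce x , reduce y)

  liftᵥ-reduceᵥ : ∀ v → liftᵥ (reduceᵥ v) ≋ᵥ v
  liftᵥ-reduceᵥ (x , y) = lift-reduce x , lift-reduce y

  ≋ᵥ⇒reduceᵥ≡ : ∀ {u u'} → u ≋ᵥ u' → reduceᵥ u ≡ reduceᵥ u'
  ≋ᵥ⇒reduceᵥ≡ (x≋ , y≋) = cong₂ _,_ (≋⇒reduce≡ x≋) (≋⇒reduce≡ y≋)

  reduceᵥ-liftᵥ : ∀ r → reduceᵥ (liftᵥ r) ≡ r
  reduceᵥ-liftᵥ (a , b) = cong₂ _,_ (reduce-lift a) (reduce-lift b)

  infixl 5 _·ᵣ_ _·ₘ_ _·_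
  _·ᵣ_ : Row → Letter k → Row
  r ·ᵣ ℓ = reduceᵥ (liftᵥ r ·ᵥ ℓ)

  ·ᵣ*-lift : ∀ r w → liftᵥ (act* _·ᵣ_ r w) ≋ᵥ liftᵥ r ·ᵥ* w
  ·ᵣ*-lift r [] = ≋ᵥ-refl (liftᵥ r)
  ·ᵣ*-lift r (ℓ ∷ w) = ≋ᵥ-trans (liftᵥ-reduceᵥ _)
    (letter-respects ℓ (liftᵥ (act* _·ᵣ_ r w)) (liftᵥ r ·ᵥ* w) (·ᵣ*-lift r w))

  ·ᵣ-cancel : ∀ r ℓ → r ·ᵣ ℓ ·ᵣ inv ℓ ≡ r
  ·ᵣ-cancel r ℓ = trans (≋ᵥ⇒reduceᵥ≡ (letter-respects (inv ℓ) _ _ (liftᵥ-reduceᵥ (liftᵥ r ·ᵥ ℓ))))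
    (trans (cong reduceᵥ (·ᵥ-cancel (liftᵥ r) ℓ)) (reduceᵥ-liftᵥ r))

  -- Matrices over ℤ/M as pairs of rows; SL₂(ℤ/M) is cut out by the
  -- decidable condition det ≡ 1 (mod M).
  Matrix : Set
  Matrix = Row × Row

  detₘ : Matrix → ℤ
  detₘ (r , r') = det (liftᵥ r) (liftᵥ r')

  det≟1 : ∀ m → Dec (reduce (detₘ m) ≡ reduce 1ℤ)
  det≟1 m = reduce (detₘ m) FinP.≟ reduce 1ℤ

  unimodular? : Matrix → Bool
  unimodular? m = isYes (det≟1 m)

  unimodular⇒det≋1 : ∀ m → T (unimodular? m) → detₘ m ≋ 1ℤ
  unimodular⇒det≋1 m t = ≋-trans (≋-sym (lift-reduce (detₘ m)))
    (≋-trans (≡⇒≋ (cong lift (toWitness {a? = det≟1 m} t))) (lift-reduce 1ℤ))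

  det≋1⇒unimodular : ∀ m → detₘ m ≋ 1ℤ → T (unimodular? m)
  det≋1⇒unimodular m det≋1 = fromWitness {a? = det≟1 m} (≋⇒reduce≡ det≋1)

  SL₂ : Set
  SL₂ = Σ Matrix (T ∘ unimodular?)

  SL₂-≡ : ∀ {g h : SL₂} → proj₁ g ≡ proj₁ h → g ≡ h
  SL₂-≡ {m , t} {.m , t'} refl = cong (m ,_) (T-irrelevant t t')

  finite-SL₂ : Finite SL₂
  finite-SL₂ = finite-Σ (finite-× finite-Row finite-Row) unimodular?
    where
    finite-Row = finite-× (finite-Fin M) (finite-Fin M)

  _·ₘ_ : Matrix → Letter k → Matrix
  (r , r') ·ₘ ℓ = (r ·ᵣ ℓ , r' ·ᵣ ℓ)

  ·ₘ-det : ∀ m ℓ → detₘ (m ·ₘ ℓ) ≋ detₘ m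
  ·ₘ-det (r , r') ℓ = ≋-trans (det-cong (liftᵥ-reduceᵥ (liftᵥ r ·ᵥ ℓ)) (liftᵥ-reduceᵥ (liftᵥ r' ·ᵥ ℓ)))
    (≡⇒≋ (letter-preserves-det ℓ (liftᵥ r) (liftᵥ r')))

  _·_ : SL₂ → Letter k → SL₂
  (m , t) · ℓ = m ·ₘ ℓ , det≋1⇒unimodular (m ·ₘ ℓ) (≋-trans (·ₘ-det m ℓ) (unimodular⇒det≋1 m t))

  ·-cancel : ∀ g ℓ → (g · ℓ) · inv ℓ ≡ g
  ·-cancel ((r , r') , _) ℓ = SL₂-≡ (cong₂ _,_ (·ᵣ-cancel r ℓ) (·ᵣ-cancel r' ℓ))

  rows-of-word : ∀ r r' t w → proj₁ (act* _·_ ((r , r') , t) w) ≡ (act* _·ᵣ_ r w , act* _·ᵣ_ r' w)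
  rows-of-word r r' t [] = refl
  rows-of-word r r' t (ℓ ∷ w) = cong (_·ₘ ℓ) (rows-of-word r r' t w)

  -- A word fixing an element of SL₂(ℤ/M) fixes both of its lifted rows modulo M.
  ·-girth : ∀ g ℓ w → Reduced (ℓ ∷ w) → K ^ length (ℓ ∷ w) < M → act* _·_ g (ℓ ∷ w) ≢ g
  ·-girth g@((r , r') , t) ℓ w reduced small fixed =
    no-fixed-pair (liftᵥ r) (liftᵥ r') (unimodular⇒det≋1 (r , r') t) ℓ w reduced small
      (lifted-fixed (cong proj₁ rows-fixed)) (lifted-fixed (cong proj₂ rows-fixed))
    where
    W = ℓ ∷ w
    rows-fixed : (act* _·ᵣ_ r W , act* _·ᵣ_ r' W) ≡ (r , r')
    rows-fixed = trans (sym (rows-of-word r r' t W)) (cong proj₁ fixed)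
    lifted-fixed : ∀ {s} → act* _·ᵣ_ s W ≡ s → liftᵥ s ·ᵥ* W ≋ᵥ liftᵥ s
    lifted-fixed {s} s-fixed = ≋ᵥ-trans (≋ᵥ-sym (·ᵣ*-lift s W)) (≡⇒≋ᵥ (cong liftᵥ s-fixed))

  one : SL₂
  one = m , det≋1⇒unimodular m (det-cong (liftᵥ-reduceᵥ (1ℤ , 0ℤ)) (liftᵥ-reduceᵥ (0ℤ , 1ℤ)))
    where
    m = (reduceᵥ (1ℤ , 0ℤ) , reduceᵥ (0ℤ , 1ℤ))

-- Girth actions exist for all k and L: take SL₂(ℤ/M) with M = 1 + K^L.
girth-action : ∀ k L → GirthAction k L
girth-action k L = record
  { Ω = SL₂
  ; finite = finite-SL₂
  ; base = one
  ; _·_ = _·_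
  ; cancel = ·-cancel
  ; girth = λ { g (ℓ ∷ w) reduced _ |W|≤L → ·-girth g ℓ w reduced (s≤s (ℕP.^-monoʳ-≤ K |W|≤L)) }
  }
  where
  open PingPong k using (K)
  open ReducedPingPong k (suc (K ^ L))

isYes-⇔ : ∀ {P Q : Set} → (P → Q) → (Q → P) → (p : Dec P) (q : Dec Q) → isYes p ≡ isYes q
isYes-⇔ P→Q Q→P (yes p) (yes q) = refl
isYes-⇔ P→Q Q→P (yes p) (no ¬q) = ⊥-elim (¬q (P→Q p))
isYes-⇔ P→Q Q→P (no ¬p) (yes q) = ⊥-elim (¬p (Q→P q))
isYes-⇔ P→Q Q→P (no ¬p) (no ¬q) = refl

share-sym : ∀ {A : Set} {xs ys : List A} → Any (_∈ ys) xs → Any (_∈ xs) ys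
share-sym shared = let (x , x∈xs , x∈ys) = find shared in lose x∈ys x∈xs

module LineGraph {k N : ℕ} (A : GirthAction k (2 + N)) where
  open GirthAction A
  open Finite finite using () renaming (_≟_ to _≟Ω_)

  -- Edge (g , j) joins g to g · (j , true); the dart (g , ℓ) leaves g along ℓ.
  Edge Dart : Set
  Edge = Ω × Fin k
  Dart = Ω × Letter k

  finite-Edge : Finite Edge
  finite-Edge = finite-× finite (finite-Fin k)

  finite-Dart : Finite Dart
  finite-Dart = finite-× finite (finite-Letter k)

  open Finite finite-Edge using () renaming (_≟_ to _≟ₑ_)
  open Finite (finite-Letter k) using () renaming (_≟_ to _≟ₗ_; elements to letters)

  no-loop : ∀ g ℓ → g · ℓ ≢ g
  no-loop g ℓ = girth g (ℓ ∷ []) tt (s≤s z≤n) (s≤s z≤n)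

  no-digon : ∀ g ℓ ℓ' → ℓ' ≢ inv ℓ → g · ℓ · ℓ' ≢ g
  no-digon g ℓ ℓ' ℓ'≢ℓ⁻¹ = girth g (ℓ' ∷ ℓ ∷ []) (ℓ'≢ℓ⁻¹ , tt) (s≤s z≤n) (s≤s (s≤s z≤n))

  edgeOf : Dart → Edge
  edgeOf (g , (j , true)) = (g , j)
  edgeOf (g , (j , false)) = (g · (j , false) , j)

  reverse : Dart → Dart
  reverse (g , ℓ) = (g · ℓ , inv ℓ)

  forward backward : Edge → Dart
  forward (g , j) = (g , (j , true))
  backward (g , j) = (g · (j , true) , (j , false))

  edgeOf-backward : ∀ e → edgeOf (backward e) ≡ e
  edgeOf-backward (g , j) = cong (_, j) (cancel g (j , true))

  edgeOf-reverse : ∀ d → edgeOf (reverse d) ≡ edgeOf d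
  edgeOf-reverse (g , (j , true)) = cong (_, j) (cancel g (j , true))
  edgeOf-reverse (g , (j , false)) = refl

  same-edge : ∀ d d' → edgeOf d ≡ edgeOf d' → d ≡ d' ⊎ d ≡ reverse d'
  same-edge (g , (j , true)) (g' , (j' , true)) refl = inj₁ refl
  same-edge (g , (j , true)) (g' , (j' , false)) refl = inj₂ refl
  same-edge (g , (j , false)) (g' , (j' , true)) refl = inj₂ (cong (_, (j , false)) (sym (cancel g (j , false))))
  same-edge (g , (j , false)) (g' , (j' , false)) eq with cong proj₂ eq
  ... | refl = inj₁ (cong (_, (j , false)) (begin
      g                           ≡⟨ cancel g (j , false) ⟨
      g · (j , false) · (j , true) ≡⟨ cong (λ h → h · (j , true)) (cong proj₁ eq) ⟩
      g' · (j , false) · (j , true) ≡⟨ cancel g' (j , false) ⟩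
      g' ∎))
    where open ≡-Reasoning

  ends : Edge → List Ω
  ends (g , j) = g ∷ g · (j , true) ∷ []

  tail∈ends : ∀ g ℓ → g ∈ ends (edgeOf (g , ℓ))
  tail∈ends g (j , true) = here refl
  tail∈ends g (j , false) = there (here (sym (cancel g (j , false))))

  target∈ends : ∀ g ℓ → g · ℓ ∈ ends (edgeOf (g , ℓ))
  target∈ends g (j , true) = there (here refl)
  target∈ends g (j , false) = here refl

  dart-at-end : ∀ {x} e → x ∈ ends e → ∃ λ ℓ → edgeOf (x , ℓ) ≡ e
  dart-at-end e (here refl) = (proj₂ e , true) , refl
  dart-at-end e (there (here refl)) = (proj₂ e , false) , edgeOf-backward e

  -- Distinct letters at a vertex give distinct edges, as there are no loops.
  edgeOf-injective-at : ∀ x {ℓ ℓ'} → edgeOf (x , ℓ) ≡ edgeOf (x , ℓ') → ℓ ≡ ℓ'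
  edgeOf-injective-at x {ℓ} {ℓ'} eq with same-edge (x , ℓ) (x , ℓ') eq
  ... | inj₁ refl = refl
  ... | inj₂ x≡x·ℓ' = ⊥-elim (no-loop x ℓ' (sym (cong proj₁ x≡x·ℓ')))

  Adjacent : Edge → Edge → Set
  Adjacent e e' = e ≢ e' × Any (_∈ ends e') (ends e)

  adjacent? : ∀ e e' → Dec (Adjacent e e')
  adjacent? e e' = ¬? (e ≟ₑ e') ×-dec any? (λ x → any? (x ≟Ω_) (ends e')) (ends e)

  adjacent-sym : ∀ {e e'} → Adjacent e e' → Adjacent e' e
  adjacent-sym (e≢e' , shared) = (e≢e' ∘ sym) , share-sym shared

  adjacent-intro : ∀ {x e e'} → e ≢ e' → x ∈ ends e → x ∈ ends e' → Adjacent e e'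
  adjacent-intro e≢e' x∈e x∈e' = e≢e' , lose x∈e x∈e'

  others : Letter k → List (Letter k)
  others ℓ = filter (λ ℓ' → ¬? (ℓ' ≟ₗ ℓ)) letters

  ∈-others : ∀ {ℓ ℓ'} → ℓ' ≢ ℓ → ℓ' ∈ others ℓ
  ∈-others {ℓ} {ℓ'} = ∈-filter⁺ (λ ℓ' → ¬? (ℓ' ≟ₗ ℓ)) (Finite.∈-elements (finite-Letter k) ℓ')

  others-≢ : ∀ {ℓ ℓ'} → ℓ' ∈ others ℓ → ℓ' ≢ ℓ
  others-≢ {ℓ} = proj₂ ∘ ∈-filter⁻ (λ ℓ' → ¬? (ℓ' ≟ₗ ℓ)) {xs = letters}

  others-unique : ∀ ℓ → Unique (others ℓ)
  others-unique ℓ = UniqueP.filter⁺ (λ ℓ' → ¬? (ℓ' ≟ₗ ℓ)) (Finite.elements-unique (finite-Letter k))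

  others-length : ∀ ℓ → suc (length (others ℓ)) ≡ k * 2
  others-length ℓ = begin
    length (ℓ ∷ others ℓ) ≡⟨ same-length (All.tabulate (λ m → others-≢ m ∘ sym) AllPairs.∷ others-unique ℓ)
                               (Finite.elements-unique (finite-Letter k))
                               (λ _ → Finite.∈-elements (finite-Letter k) _) split ⟩
    length letters        ≡⟨ ListP.length-map _ (allFin (k * 2)) ⟩
    length (allFin (k * 2)) ≡⟨ ListP.length-tabulate (λ i → i) ⟩
    k * 2 ∎
    where
    open ≡-Reasoning
    split : ∀ {ℓ'} → ℓ' ∈ letters → ℓ' ∈ ℓ ∷ others ℓ
    split {ℓ'} _ with ℓ' ≟ₗ ℓ
    ... | yes ℓ'≡ℓ = here ℓ'≡ℓ
    ... | no ℓ'≢ℓ = there (∈-others ℓ'≢ℓ)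

  edges-except : Dart → List Edge
  edges-except (x , ℓ) = map (λ ℓ' → edgeOf (x , ℓ')) (others ℓ)

  ∈-edges-except⁻ : ∀ {e'} x ℓ → e' ∈ edges-except (x , ℓ) → e' ≢ edgeOf (x , ℓ) × x ∈ ends e'
  ∈-edges-except⁻ x ℓ e'∈ with ∈-map⁻ (λ ℓ' → edgeOf (x , ℓ')) e'∈
  ... | ℓ' , ℓ'∈ , refl = (others-≢ ℓ'∈ ∘ edgeOf-injective-at x) , tail∈ends x ℓ'

  ∈-edges-except⁺ : ∀ {e'} x ℓ → x ∈ ends e' → e' ≢ edgeOf (x , ℓ) → e' ∈ edges-except (x , ℓ)
  ∈-edges-except⁺ {e'} x ℓ x∈e' e'≢ with dart-at-end e' x∈e'
  ... | ℓ' , refl = ∈-map⁺ (λ ℓ' → edgeOf (x , ℓ')) (∈-others (e'≢ ∘ cong (λ l → edgeOf (x , l))))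

  edges-except-unique : ∀ d → Unique (edges-except d)
  edges-except-unique (x , ℓ) = UniqueP.map⁺ (edgeOf-injective-at x) (others-unique ℓ)

  neighbours : Edge → List Edge
  neighbours e = edges-except (forward e) ++ edges-except (backward e)

  -- No edge other than e joins the two endpoints of e, since there are no digons.
  neighbours-disjoint : ∀ e {e'} → e' ∈ edges-except (forward e) → e' ∈ edges-except (backward e) → ⊥
  neighbours-disjoint (g , j) at-tail at-head
    with ∈-map⁻ (λ ℓ → edgeOf (g , ℓ)) at-tail | ∈-map⁻ (λ ℓ → edgeOf (g · (j , true) , ℓ)) at-head
  ... | ℓ , _ , e'≡ | ℓ' , ℓ'∈ , e'≡' with same-edge (g , ℓ) (g · (j , true) , ℓ') (trans (sym e'≡) e'≡')
  ... | inj₁ same = no-loop g (j , true) (sym (cong proj₁ same))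
  ... | inj₂ reversed = no-digon g (j , true) ℓ' (others-≢ ℓ'∈) (sym (cong proj₁ reversed))

  neighbours-unique : ∀ e → Unique (neighbours e)
  neighbours-unique e = UniqueP.++⁺ (edges-except-unique (forward e)) (edges-except-unique (backward e))
    (λ (at-tail , at-head) → neighbours-disjoint e at-tail at-head)

  neighbours⇒adjacent : ∀ e e' → e' ∈ neighbours e → Adjacent e e'
  neighbours⇒adjacent e@(g , j) e' e'∈ with ∈-++⁻ (edges-except (forward e)) e'∈
  ... | inj₁ at-tail = let (e'≢e , g∈e') = ∈-edges-except⁻ g (j , true) at-tail
                       in adjacent-intro (e'≢e ∘ sym) (here refl) g∈e'
  ... | inj₂ at-head = let (e'≢e , h∈e') = ∈-edges-except⁻ (g · (j , true)) (j , false) at-head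
                       in adjacent-intro (λ e≡e' → e'≢e (trans (sym e≡e') (sym (edgeOf-backward e)))) (there (here refl)) h∈e'

  adjacent⇒neighbours : ∀ e e' → Adjacent e e' → e' ∈ neighbours e
  adjacent⇒neighbours e@(g , j) e' (e≢e' , shared) with find shared
  ... | x , here refl , x∈e' =
    ∈-++⁺ˡ (∈-edges-except⁺ g (j , true) x∈e' (e≢e' ∘ sym))
  ... | x , there (here refl) , x∈e' =
    ∈-++⁺ʳ (edges-except (forward e)) (∈-edges-except⁺ x (j , false) x∈e' (e≢e' ∘ sym ∘ flip-backward))
    where
    flip-backward : e' ≡ edgeOf (backward e) → e' ≡ e
    flip-backward eq = trans eq (edgeOf-backward e)

  neighbours-length : ∀ e → length (neighbours e) ≡ 4 * k ∸ 2
  neighbours-length e = begin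
    length (neighbours e)
      ≡⟨ ListP.length-++ (edges-except (forward e)) ⟩
    length (edges-except (forward e)) + length (edges-except (backward e))
      ≡⟨ cong₂ _+_ (ListP.length-map _ (others (proj₂ (forward e))))
                   (ListP.length-map _ (others (proj₂ (backward e)))) ⟩
    length (others (proj₂ (forward e))) + length (others (proj₂ (backward e)))
      ≡⟨ two-less (others-length _) (others-length _) ⟩
    4 * k ∸ 2 ∎
    where
    open ≡-Reasoning
    two-less : ∀ {a b} → suc a ≡ k * 2 → suc b ≡ k * 2 → a + b ≡ 4 * k ∸ 2
    two-less {a} {b} a+1≡2k b+1≡2k = begin
      a + b                   ≡⟨ cong (_∸ 2) (ℕP.+-suc (suc a) b) ⟨
      suc a + suc b ∸ 2       ≡⟨ cong₂ (λ s t → s + t ∸ 2) a+1≡2k b+1≡2k ⟩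
      k * 2 + k * 2 ∸ 2       ≡⟨ cong (_∸ 2) (double k) ⟩
      4 * k ∸ 2 ∎
      where
      double : ∀ k → k * 2 + k * 2 ≡ 4 * k
      double = ℕ-solve-∀

  open Finite finite-Edge using (index; element; element-index; index-element; index-injective)

  lineGraph : Graph
  lineGraph = record
    { n = Finite.size finite-Edge
    ; adj = λ u v → isYes (adjacent? (element u) (element v))
    ; sym = λ u v → isYes-⇔ adjacent-sym adjacent-sym (adjacent? (element u) (element v)) (adjacent? (element v) (element u))
    ; irrefl = λ v → isYes-⇔ (λ adj → proj₁ adj refl) ⊥-elim (adjacent? (element v) (element v)) (no λ ())
    }

  adjacent⇒adj : ∀ e e' → Adjacent e e' → T (adj lineGraph (index e) (index e'))
  adjacent⇒adj e e' e~e' = fromWitness (subst₂ Adjacent (sym (element-index e)) (sym (element-index e')) e~e')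

  regular : Regular (4 * k ∸ 2) lineGraph
  regular v = begin
    degree lineGraph v                             ≡⟨ same-length
                                                        (UniqueP.filter⁺ (λ u → T? (adj lineGraph v u)) (UniqueP.allFin⁺ _))
                                                        (UniqueP.map⁺ index-injective (neighbours-unique (element v)))
                                                        adjacent-listed listed-adjacent ⟩
    length (map index (neighbours (element v)))    ≡⟨ ListP.length-map index (neighbours (element v)) ⟩
    length (neighbours (element v))                ≡⟨ neighbours-length (element v) ⟩
    4 * k ∸ 2 ∎
    where
    open ≡-Reasoning
    adjacent-listed : ∀ {u} → u ∈ filter (λ u → T? (adj lineGraph v u)) (allFin _) → u ∈ map index (neighbours (element v))
    adjacent-listed {u} u∈ = subst (_∈ map index (neighbours (element v))) (index-element u)
      (∈-map⁺ index (adjacent⇒neighbours (element v) (element u)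
        (toWitness (proj₂ (∈-filter⁻ (λ u → T? (adj lineGraph v u)) {xs = allFin _} u∈)))))
    listed-adjacent : ∀ {u} → u ∈ map index (neighbours (element v)) → u ∈ filter (λ u → T? (adj lineGraph v u)) (allFin _)
    listed-adjacent u∈ with ∈-map⁻ index u∈
    ... | e' , e'∈ , refl = ∈-filter⁺ (λ u → T? (adj lineGraph v u)) (∈-allFin (index e'))
      (subst (λ u → T (adj lineGraph u (index e'))) (index-element v)
        (adjacent⇒adj (element v) e' (neighbours⇒adjacent (element v) e' e'∈)))

  consecutive-adjacent : ∀ g ℓ ℓ' → ℓ' ≢ inv ℓ → Adjacent (edgeOf (g , ℓ)) (edgeOf (g · ℓ , ℓ'))
  consecutive-adjacent g ℓ ℓ' ℓ'≢ℓ⁻¹ = adjacent-intro distinct (target∈ends g ℓ) (tail∈ends (g · ℓ) ℓ')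
    where
    distinct : edgeOf (g , ℓ) ≢ edgeOf (g · ℓ , ℓ')
    distinct eq with same-edge (g , ℓ) (g · ℓ , ℓ') eq
    ... | inj₁ same = no-loop g ℓ (sym (cong proj₁ same))
    ... | inj₂ reversed = no-digon g ℓ ℓ' ℓ'≢ℓ⁻¹ (sym (cong proj₁ reversed))

  ends-of-dart : ∀ {x} g ℓ → x ∈ ends (edgeOf (g , ℓ)) → x ≡ g ⊎ x ≡ g · ℓ
  ends-of-dart g (j , true) (here x≡g) = inj₁ x≡g
  ends-of-dart g (j , true) (there (here x≡g·ℓ)) = inj₂ x≡g·ℓ
  ends-of-dart g (j , false) (here x≡g·ℓ) = inj₂ x≡g·ℓ
  ends-of-dart g (j , false) (there (here x≡g·ℓ·ℓ⁻¹)) = inj₁ (trans x≡g·ℓ·ℓ⁻¹ (cancel g (j , false)))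

  -- A colouring of the vertices of the line graph, i.e. of the edges.
  module Colouring (c : Vertex lineGraph → Fin k) where

    colour : Edge → Fin k
    colour e = c (index e)

    next : Dart → Letter k → Dart
    next (g , ℓ) ℓ' = (g · ℓ , ℓ')

    continuations : Dart → List (Letter k)
    continuations (g , ℓ) = others (inv ℓ)

    -- A non-backtracking walk of colour i with n + 1 edges, starting with d.
    data Trail (i : Fin k) : Dart → ℕ → Set where
      stop : ∀ {d} → colour (edgeOf d) ≡ i → Trail i d zero
      step : ∀ {g ℓ ℓ' n} → colour (edgeOf (g , ℓ)) ≡ i → ℓ' ≢ inv ℓ →
             Trail i (g · ℓ , ℓ') n → Trail i (g , ℓ) (suc n)

    opaque
      -- height i n d is the number of edges, capped at n, of a longest
      -- non-backtracking walk of colour i starting with the dart d.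
      height : Fin k → ℕ → Dart → ℕ
      height i zero d = 0
      height i (suc n) d = extend (colour (edgeOf d) Fin.≟ i) (maxOf (height i n ∘ next d) (continuations d))
        where
        extend : ∀ {P : Set} → Dec P → ℕ → ℕ
        extend (yes _) m = suc m
        extend (no _) _ = 0

      height-stable : ∀ i n d → height i n d < n → height i (suc n) d ≡ height i n d
      height-stable i (suc n) d short with colour (edgeOf d) Fin.≟ i
      ... | no _ = refl
      ... | yes _ = cong suc (maxOf-cong _ _ (continuations d) λ {ℓ} ℓ∈ →
            height-stable i n (next d ℓ) (ℕP.≤-<-trans (≤-maxOf (height i n ∘ next d) ℓ∈) (ℕ.s≤s⁻¹ short)))

      height-trail : ∀ i n d → suc n ≤ height i (suc n) d → Trail i d n
      height-trail i n d@(g , ℓ) long with colour (edgeOf d) Fin.≟ i | n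
      ... | no _ | _ = ⊥-elim (ℕP.n≮0 long)
      ... | yes c≡i | zero = stop c≡i
      ... | yes c≡i | suc m with maxOf-attained (height i (suc m) ∘ next d) (continuations d) (ℕ.s≤s⁻¹ long)
      ...   | ℓ' , ℓ'∈ , long' = step c≡i (others-≢ ℓ'∈) (height-trail i m (g · ℓ , ℓ') long')

      height-step : ∀ i n g ℓ ℓ' → height i n (g , ℓ) < n → colour (edgeOf (g , ℓ)) ≡ i → ℓ' ≢ inv ℓ →
                    suc (height i n (g · ℓ , ℓ')) ≤ height i n (g , ℓ)
      height-step i n g ℓ ℓ' short c≡i ℓ'≢ℓ⁻¹ =
        subst (suc (height i n (g · ℓ , ℓ')) ≤_) (height-stable i n (g , ℓ) short) grows
        where
        grows : suc (height i n (g · ℓ , ℓ')) ≤ height i (suc n) (g , ℓ)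
        grows with colour (edgeOf (g , ℓ)) Fin.≟ i
        ... | yes _ = s≤s (≤-maxOf (height i n ∘ next (g , ℓ)) (∈-others ℓ'≢ℓ⁻¹))
        ... | no c≢i = ⊥-elim (c≢i c≡i)

    -- Orienting each
    -- edge towards its longer walks makes its source injective within each
    -- colour class, hence (counting) every vertex is the source of an edge
    -- of every colour; following these edges, heights decrease forever.
    module IfAllShort (short : ∀ i d → height i (suc N) d < suc N) where

      -- At the cap suc N all heights have stabilised.
      h : Fin k → Dart → ℕ
      h i = height i (suc N)

      turn : ∀ i d d' → proj₁ d ≡ proj₁ d' → proj₂ d' ≢ proj₂ d → colour (edgeOf d) ≡ i →
             suc (h i d') ≤ h i (reverse d)
      turn i (g , ℓ) (.g , ℓ') refl ℓ'≢ℓ colour≡i =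
        subst (λ x → suc (h i (x , ℓ')) ≤ h i (reverse (g , ℓ))) (cancel g ℓ)
          (height-step i (suc N) (g · ℓ) (inv ℓ) ℓ' (short i _) (trans (cong colour (edgeOf-reverse (g , ℓ))) colour≡i)
            (λ ℓ'≡ → ℓ'≢ℓ (trans ℓ'≡ (inv-involutive ℓ))))

      out : Edge → Dart
      out e with h (colour e) (forward e) ℕ.≤? h (colour e) (backward e)
      ... | yes _ = backward e
      ... | no _ = forward e

      out-edge : ∀ e → edgeOf (out e) ≡ e
      out-edge e with h (colour e) (forward e) ℕ.≤? h (colour e) (backward e)
      ... | yes _ = edgeOf-backward e
      ... | no _ = refl

      out-longer : ∀ e → h (colour e) (reverse (out e)) ≤ h (colour e) (out e)
      out-longer e@(g , j) with h (colour e) (forward e) ℕ.≤? h (colour e) (backward e)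
      ... | yes fwd≤bwd = subst (λ x → h (colour e) (x , (j , true)) ≤ h (colour e) (backward e))
                            (sym (cancel g (j , true))) fwd≤bwd
      ... | no fwd≰bwd = ℕP.<⇒≤ (ℕP.≰⇒> fwd≰bwd)

      source : Edge → Ω
      source e = proj₁ (out e)

      colour-out : ∀ e → colour (edgeOf (out e)) ≡ colour e
      colour-out e = cong colour (out-edge e)

      -- Distinct edges of one colour have distinct sources: each would
      -- continue the reverse of the other, so each would be higher.
      source-injective : ∀ e e' → colour e ≡ colour e' → source e ≡ source e' → e ≡ e'
      source-injective e e' same-colour same-source with e ≟ₑ e'
      ... | yes e≡e' = e≡e'
      ... | no e≢e' = ⊥-elim (ℕP.<-asym e'<e e<e')
        where
        i = colour e
        letters-differ : proj₂ (out e') ≢ proj₂ (out e)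
        letters-differ same-letter = e≢e' (begin
          e                 ≡⟨ out-edge e ⟨
          edgeOf (out e)    ≡⟨ cong edgeOf (cong₂ _,_ same-source (sym same-letter)) ⟩
          edgeOf (out e')   ≡⟨ out-edge e' ⟩
          e'                ∎)
          where open ≡-Reasoning
        e'<e : h i (out e') < h i (out e)
        e'<e = ℕP.<-≤-trans (turn i (out e) (out e') same-source letters-differ (colour-out e)) (out-longer e)
        e<e' : h i (out e) < h i (out e')
        e<e' = subst (λ i' → h i' (out e) < h i' (out e')) (sym same-colour)
          (ℕP.<-≤-trans (turn (colour e') (out e') (out e) (sym same-source) (letters-differ ∘ sym) (colour-out e'))
            (out-longer e'))

      -- Hence e ↦ (source e , colour e) is a bijection of the edges, so every
      -- vertex is the source of an edge of every colour.
      opaque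
        source-of : ∀ v i → ∃ λ e → source e ≡ v × colour e ≡ i
        source-of v i =
          let (e , labelled) = injective⇒surjective finite-Edge label label-injective (v , i)
          in e , cong proj₁ labelled , cong proj₂ labelled
          where
          label : Edge → Edge
          label e = (source e , colour e)
          label-injective : ∀ {e e'} → label e ≡ label e' → e ≡ e'
          label-injective {e} {e'} eq = source-injective e e' (cong proj₂ eq) (cong proj₁ eq)

      module _ (i : Fin k) where

        pre : Ω → Edge
        pre v = proj₁ (source-of v i)

        -- Leaving v along its edge of colour i and then taking the edge of
        -- colour i leaving the new vertex is a non-backtracking step.
        falls : ∀ v → suc (h i (out (pre (proj₁ (out (pre v)) · proj₂ (out (pre v)))))) ≤ h i (out (pre v))
        falls v = subst (λ d' → suc (h i d') ≤ h i (g , ℓ)) (sym out-e'≡)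
          (height-step i (suc N) g ℓ ℓ' (short i (g , ℓ))
            (trans (colour-out e) (proj₂ (proj₂ (source-of v i)))) not-back)
          where
          e = pre v
          g = proj₁ (out e)
          ℓ = proj₂ (out e)
          e' = pre (g · ℓ)
          ℓ' = proj₂ (out e')
          out-e'≡ : out e' ≡ (g · ℓ , ℓ')
          out-e'≡ = cong (_, ℓ') (proj₁ (proj₂ (source-of (g · ℓ) i)))
          not-back : ℓ' ≢ inv ℓ
          not-back ℓ'≡ℓ⁻¹ = no-loop g ℓ (begin
            g · ℓ                       ≡⟨ proj₁ (proj₂ (source-of (g · ℓ) i)) ⟨
            source e'                   ≡⟨ cong source same-edge' ⟩
            source e                    ∎)
            where
            open ≡-Reasoning
            same-edge' : e' ≡ e
            same-edge' = begin
              e'                        ≡⟨ out-edge e' ⟨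
              edgeOf (out e')           ≡⟨ cong edgeOf (trans out-e'≡ (cong (g · ℓ ,_) ℓ'≡ℓ⁻¹)) ⟩
              edgeOf (reverse (out e))  ≡⟨ edgeOf-reverse (out e) ⟩
              edgeOf (out e)            ≡⟨ out-edge e ⟩
              e                         ∎

        -- Heights along the chain of sources exceed every bound t; t = N + 1 is absurd.
        descent : ∀ t v → t ≤ h i (out (pre v))
        descent zero v = z≤n
        descent (suc t) v = ℕP.≤-trans (s≤s (descent t _)) (falls v)

        impossible : ⊥
        impossible = ℕP.<-irrefl refl (ℕP.≤-<-trans (descent (suc N) base) (short i (out (pre base))))

    visited : ∀ {i d n} → Trail i d n → List Ω
    visited (stop {d = g , ℓ} _) = g ∷ g · ℓ ∷ []
    visited (step {g = g} _ _ t) = g ∷ visited t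

    trail-edges : ∀ {i d n} → Trail i d n → List Edge
    trail-edges (stop {d = d} _) = edgeOf d ∷ []
    trail-edges (step {g = g} {ℓ = ℓ} _ _ t) = edgeOf (g , ℓ) ∷ trail-edges t

    trail-edges-length : ∀ {i d n} (t : Trail i d n) → length (trail-edges t) ≡ suc n
    trail-edges-length (stop _) = refl
    trail-edges-length (step _ _ t) = cong suc (trail-edges-length t)

    start-visited : ∀ {i g ℓ n} (t : Trail i (g , ℓ) n) → g ∈ visited t
    start-visited (stop _) = here refl
    start-visited (step _ _ _) = here refl

    ends-visited : ∀ {i d n} (t : Trail i d n) {e x} → e ∈ trail-edges t → x ∈ ends e → x ∈ visited t
    ends-visited (stop {d = g , ℓ} _) (here refl) x∈ with ends-of-dart g ℓ x∈
    ... | inj₁ x≡g = here x≡g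
    ... | inj₂ x≡g·ℓ = there (here x≡g·ℓ)
    ends-visited (step {g = g} {ℓ = ℓ} _ _ t) (here refl) x∈ with ends-of-dart g ℓ x∈
    ... | inj₁ x≡g = here x≡g
    ... | inj₂ refl = there (start-visited t)
    ends-visited (step _ _ t) (there e∈) x∈ = there (ends-visited t e∈ x∈)

    start-avoids : ∀ {g ℓ} g₀ w → Reduced (ℓ ∷ w) → g ≡ act* _·_ g₀ w → 1 ≤ length w → length w ≤ 2 + N → g₀ ≢ g
    start-avoids g₀ w reduced g≡ 1≤|w| |w|≤ g₀≡g = girth g₀ w (reduced-tail w reduced) 1≤|w| |w|≤ (trans (sym g≡) (sym g₀≡g))

    avoids : ∀ {i g ℓ n} (t : Trail i (g , ℓ) n) g₀ w → Reduced (ℓ ∷ w) → g ≡ act* _·_ g₀ w →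
             1 ≤ length w → length w + suc n ≤ 2 + N → All (g₀ ≢_) (visited t)
    avoids {g = g} {ℓ} (stop _) g₀ w reduced g≡ 1≤|w| bound =
      start-avoids g₀ w reduced g≡ 1≤|w| (ℕP.≤-trans (ℕP.m≤m+n (length w) 1) bound)
      ∷ (λ g₀≡g·ℓ → girth g₀ (ℓ ∷ w) reduced (s≤s z≤n) (subst (_≤ 2 + N) (ℕP.+-comm (length w) 1) bound)
                      (trans (cong (_· ℓ) (sym g≡)) (sym g₀≡g·ℓ)))
      ∷ []
    avoids {g = g} {ℓ} (step {ℓ' = ℓ'} {n = n} _ ℓ'≢ℓ⁻¹ t) g₀ w reduced g≡ 1≤|w| bound =
      start-avoids g₀ w reduced g≡ 1≤|w| (ℕP.≤-trans (ℕP.m≤m+n (length w) (2 + n)) bound)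
      ∷ avoids t g₀ (ℓ ∷ w) (ℓ'≢ℓ⁻¹ , reduced) (cong (_· ℓ) g≡) (s≤s z≤n)
          (subst (_≤ 2 + N) (ℕP.+-suc (length w) (suc n)) bound)

    trail-edges-unique : ∀ {i d n} (t : Trail i d n) → n ≤ N → Unique (trail-edges t)
    trail-edges-unique (stop _) _ = [] AllPairs.∷ AllPairs.[]
    trail-edges-unique (step {g = g} {ℓ = ℓ} {n = n} _ ℓ'≢ℓ⁻¹ t) n<N =
      All.tabulate fresh AllPairs.∷ trail-edges-unique t (ℕP.<⇒≤ n<N)
      where
      fresh : ∀ {e} → e ∈ trail-edges t → edgeOf (g , ℓ) ≢ e
      fresh e∈ refl = AllP.All¬⇒¬Any (avoids t g (ℓ ∷ []) (ℓ'≢ℓ⁻¹ , tt) refl (s≤s z≤n) (s≤s (ℕP.m≤n⇒m≤1+n n<N)))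
                                (ends-visited t e∈ (tail∈ends g ℓ))

    trail-connected : ∀ {i d n} (t : Trail i d n) → All (ConnIn lineGraph (λ v → c v ≡ i) (index (edgeOf d))) (map index (trail-edges t))
    trail-connected (stop c≡i) = ConnIn.here c≡i ∷ []
    trail-connected (step {g = g} {ℓ} {ℓ'} c≡i ℓ'≢ℓ⁻¹ t) =
      ConnIn.here c≡i ∷ All.map (ConnIn.step c≡i (adjacent⇒adj _ _ (consecutive-adjacent g ℓ ℓ' ℓ'≢ℓ⁻¹))) (trail-connected t)

    trail-component : ∀ {i d} → Trail i d N → HasBigComponent lineGraph (λ v → c v ≡ i) (suc N)
    trail-component {d = d} t = index (edgeOf d) , map index (trail-edges t)
      , UniqueP.map⁺ index-injective (trail-edges-unique t ℕP.≤-refl)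
      , ℕP.≤-reflexive (sym (trans (ListP.length-map index (trail-edges t)) (trail-edges-length t)))
      , trail-connected t

    long-trail : Fin k → ∃[ i ] ∃[ d ] Trail i d N
    long-trail i₀ with Finite.search (finite-× (finite-Fin k) finite-Dart)
                         {P = λ p → height (proj₁ p) (suc N) (proj₂ p) < suc N}
                         (λ p → height (proj₁ p) (suc N) (proj₂ p) ℕ.<? suc N)
    ... | inj₁ all-short = ⊥-elim (IfAllShort.impossible (λ i d → all-short (i , d)) i₀)
    ... | inj₂ ((i , d) , ¬short) = i , d , height-trail i N d (ℕP.≮⇒≥ ¬short)

  monochromatic-component : Fin k → (c : Vertex lineGraph → Fin k) →
                            ∃[ i ] HasBigComponent lineGraph (λ v → c v ≡ i) (suc N)
  monochromatic-component i₀ c = let (i , d , t) = long-trail i₀ in i , trail-component t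
    where open Colouring c

theorem4p3 : (k N : ℕ) → 1 ≤ k → 1 ≤ N →
    Σ Graph λ G → Regular (4 * k ∸ 2) G ×
      ((c : Vertex G → Fin k) →
        ∃[ i ] HasBigComponent G (λ v → c v ≡ i) N)
theorem4p3 (suc k) (suc N) _ _ = lineGraph , regular , monochromatic-component Fin.zero
  where open LineGraph (girth-action (suc k) (2 + N))
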